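{- Let $T$ be a tree of order $n$ with diameter $D(T)=3$. Then $\operatorname{Sd}_s(T,T^c)=n-2$.
   Context: All graphs are finite, simple and undirected; $T^c$ denotes the complement of $T$ on the same vertex set. For a connected graph $H$, $d_H(x,y)$ is the length of a shortest $x$–$y$ path; a vertex $w$ strongly resolves $u,v$ if $d_H(u,w)=d_H(u,v)+d_H(v,w)$ or $d_H(v,w)=d_H(v,u)+d_H(u,w)$; a set $S\subseteq V(H)$ is a strong metric generator for $H$ if every two distinct vertices are strongly resolved by some vertex of $S$. For connected graphs $G_1,\dots,G_k$ on a common vertex set $V$, $\operatorname{Sd}_s(G_1,\dots,G_k)$ is the minimum cardinality of a set $S\subseteq V$ that is a strong metric generator for every $G_i$. -}

module Defs where

open import Data.Nat using (ℕ; zero; suc; _+_; _≤_)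
open import Data.Bool using (Bool; true; false; not; _∧_)
open import Data.Fin using (Fin)
open import Data.Fin.Properties using (_≟_)
open import Data.Fin.Subset using (Subset; _∈_; ∣_∣)
open import Data.List using (List; []; _∷_; length; _++_)
open import Data.Sum using (_⊎_)
open import Data.List.Relation.Unary.Unique.Propositional using (Unique)
open import Data.Product using (Σ; ∃; ∃-syntax; _×_; _,_)
open import Relation.Binary.PropositionalEquality using (_≡_; _≢_)
open import Relation.Nullary using (¬_)
open import Relation.Nullary.Decidable using (⌊_⌋)

record Graph (n : ℕ) : Set where
  field
    adj     : Fin n → Fin n → Bool
    adj-sym : ∀ u v → adj u v ≡ adj v u
    adj-irr : ∀ u → adj u u ≡ false
open Graph public

Adj : ∀ {n} → Graph n → Fin n → Fin n → Set
Adj G u v = adj G u v ≡ true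

complement : ∀ {n} → Graph n → Graph n
complement {n} G = record
  { adj     = λ u v → not (adj G u v) ∧ not ⌊ u ≟ v ⌋
  ; adj-sym = sym'
  ; adj-irr = irr
  }
  where
  open import Relation.Binary.PropositionalEquality using (refl; cong₂; sym)
  open import Relation.Nullary using (yes; no)
  eqb : ∀ (u v : Fin n) → ⌊ u ≟ v ⌋ ≡ ⌊ v ≟ u ⌋
  eqb u v with u ≟ v | v ≟ u
  ... | yes _ | yes _ = refl
  ... | no _  | no _  = refl
  ... | yes p | no q  = Data.Empty.⊥-elim (q (sym p))
    where import Data.Empty
  ... | no p  | yes q = Data.Empty.⊥-elim (p (sym q))
    where import Data.Empty
  sym' : ∀ u v → (not (adj G u v) ∧ not ⌊ u ≟ v ⌋) ≡ (not (adj G v u) ∧ not ⌊ v ≟ u ⌋)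
  sym' u v = cong₂ (λ a b → not a ∧ not b) (adj-sym G u v) (eqb u v)
  irr : ∀ u → (not (adj G u u) ∧ not ⌊ u ≟ u ⌋) ≡ false
  irr u with u ≟ u
  ... | yes _ = Data.Bool.Properties.∧-zeroʳ (not (adj G u u))
    where import Data.Bool.Properties
  ... | no ¬p = Data.Empty.⊥-elim (¬p refl)
    where import Data.Empty

data Walk {n : ℕ} (G : Graph n) : Fin n → Fin n → ℕ → Set where
  here : ∀ {u} → Walk G u u zero
  step : ∀ {u w v k} → Adj G u w → Walk G w v k → Walk G u v (suc k)

IsDist : ∀ {n} → Graph n → Fin n → Fin n → ℕ → Set
IsDist G u v d = Walk G u v d × (∀ k → Walk G u v k → d ≤ k)

Connected : ∀ {n} → Graph n → Set
Connected {n} G = ∀ (u v : Fin n) → ∃[ k ] Walk G u v k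

data Chain {n : ℕ} (G : Graph n) : Fin n → List (Fin n) → Set where
  end  : ∀ {u} → Chain G u []
  link : ∀ {u w vs} → Adj G u w → Chain G w vs → Chain G u (w ∷ vs)

data Cycle {n : ℕ} (G : Graph n) : Set where
  cycle : ∀ (v₀ : Fin n) (vs : List (Fin n)) (last : Fin n) →
          2 ≤ suc (length vs) →
          Unique (v₀ ∷ vs ++ (last ∷ [])) →
          Chain G v₀ (vs ++ (last ∷ [])) →
          Adj G last v₀ →
          Cycle G

Acyclic : ∀ {n} → Graph n → Set
Acyclic G = ¬ Cycle G

IsTree : ∀ {n} → Graph n → Set
IsTree G = Connected G × Acyclic G

HasDiameter : ∀ {n} → Graph n → ℕ → Set
HasDiameter {n} G d =
  (∀ (u v : Fin n) (e : ℕ) → IsDist G u v e → e ≤ d) ×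
  (∃[ u ] ∃[ v ] IsDist G u v d)

StronglyResolves : ∀ {n} → Graph n → Fin n → Fin n → Fin n → Set
StronglyResolves G w u v =
  (Σ ℕ λ a → Σ ℕ λ b → Σ ℕ λ c →
     IsDist G u w a × IsDist G u v b × IsDist G v w c × a ≡ b + c)
  ⊎
  (Σ ℕ λ a → Σ ℕ λ b → Σ ℕ λ c →
     IsDist G v w a × IsDist G v u b × IsDist G u w c × a ≡ b + c)

IsStrongMetricGenerator : ∀ {n} → Graph n → Subset n → Set
IsStrongMetricGenerator {n} G S =
  ∀ (u v : Fin n) → u ≢ v → ∃[ w ] (w ∈ S × StronglyResolves G w u v)

IsSimStrongMetricGenerator : ∀ {n} → Graph n → Graph n → Subset n → Set
IsSimStrongMetricGenerator G₁ G₂ S =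
  IsStrongMetricGenerator G₁ S × IsStrongMetricGenerator G₂ S

SimStrongMetricDim≡ : ∀ {n} → Graph n → Graph n → ℕ → Set
SimStrongMetricDim≡ {n} G₁ G₂ m =
  (∃[ S ] (IsSimStrongMetricGenerator G₁ G₂ S × ∣ S ∣ ≡ m)) ×
  (∀ (S : Subset n) → IsSimStrongMetricGenerator G₁ G₂ S → m ≤ ∣ S ∣)

module Submission where

-- Let u a b v be a diametral path.  Since T is a tree of diameter 3, every vertex other than a, b
-- is a leaf attached to exactly one of them.  A leaf is interior to no shortest path, so in T two
-- leaves are strongly resolved only by themselves; in the complement a and b are at distance 3
-- while every other vertex is within distance 2 of both, so a and b are strongly resolved only by
-- themselves.  Among any three vertices two are leaves or they are a and b, hence a simultaneous
-- generator misses at most two vertices.  Conversely V ∖ {u, a} works: b strongly resolves u, a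
-- in T (along u a b) and in the complement (along a v u b).

open import Defs
open import Data.Bool using (true; false)
import Data.Bool.Properties as Bool
open import Data.Empty using (⊥; ⊥-elim)
open import Data.Fin using (Fin; zero; suc)
open import Data.Fin.Properties using (_≟_; any?; suc-injective)
open import Data.Fin.Subset using (Subset; _∈_; _∉_; ∣_∣; ⁅_⁆; _∪_; ∁; Nonempty; inside; outside)
open import Data.Fin.Subset.Properties
  using (_∈?_; x∈p∪q⁻; x∉∁p⇒x∈p; x∉p⇒x∈∁p; x∈∁p⇒x∉p; x∈⁅y⁆⇒x≡y; ∣∁p∣≡n∸∣p∣; ∣⁅x⁆∣≡1; ∪-identityˡ; ∪-identityʳ)
open import Data.List using (List; []; _∷_; length; _++_)
open import Data.List.Properties using (++-assoc)
open import Data.List.Membership.Propositional using () renaming (_∈_ to _∈ˡ_)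
open import Data.List.Membership.Propositional.Properties using (∈-∃++)
open import Data.List.Relation.Unary.All using ([]; _∷_; lookup)
open import Data.List.Relation.Unary.All.Properties using (¬Any⇒All¬; ++⁻ˡ)
open import Data.List.Relation.Unary.AllPairs using ([]; _∷_)
open import Data.List.Relation.Unary.Any using (here; there)
open import Data.List.Relation.Unary.Unique.Propositional using (Unique)
open import Data.Vec.Base using (_∷_; _[_]=_)
open _[_]=_
open import Data.Nat using (ℕ; zero; suc; _+_; _∸_; _≤_; _<_; z≤n; s≤s; _≤?_)
open import Data.Nat.Induction using (<-wellFounded)
open import Data.Nat.Properties
  using (≤-refl; ≤-trans; n≤1+n; m≤n⇒m≤1+n; m≤m+n; <⇒≱; ≮⇒≥; ≰⇒>; +-mono-<; +-monoʳ-≤; +-comm; +-identityʳ;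
         m≤n+m∸n; m≤n+o⇒m∸n≤o; ≤-pred; anyUpTo?; module ≤-Reasoning)
open import Data.Product using (Σ; ∃-syntax; ∃₂; _×_; _,_; proj₂)
import Data.Product as Product
open import Data.Sum using (_⊎_; inj₁; inj₂; [_,_])
import Data.Sum as Sum
open import Function using (_∘_)
open import Induction.WellFounded using (Acc; acc)
open import Relation.Binary.PropositionalEquality using (_≡_; _≢_; refl; sym; trans; subst; cong; ≢-sym)
open import Relation.Nullary using (¬_; Dec; yes; no)
open import Relation.Nullary.Decidable using (_×-dec_)
open import Relation.Unary using (Decidable)

least-witness : ∀ {P : ℕ → Set} → Decidable P → ∀ {m} → P m → ∃[ k ] (P k × (∀ {j} → P j → k ≤ j))
least-witness {P} P? {m} pm = go m (<-wellFounded m) pm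
  where
  go : ∀ m → Acc _<_ m → P m → ∃[ k ] (P k × (∀ {j} → P j → k ≤ j))
  go m (acc smaller) pm with anyUpTo? P? m
  ... | yes (j , j<m , pj) = go j (smaller j<m) pj
  ... | no none = m , pm , λ {j} pj → ≮⇒≥ (λ j<m → none (j , j<m , pj))

allBut : ∀ {n} → Fin n → Fin n → Subset n
allBut x y = ∁ (⁅ x ⁆ ∪ ⁅ y ⁆)

∈allBut : ∀ {n} {x y z : Fin n} → z ≢ x → z ≢ y → z ∈ allBut x y
∈allBut {x = x} {y} z≢x z≢y = x∉p⇒x∈∁p λ z∈ →
  [ z≢x ∘ x∈⁅y⁆⇒x≡y x , z≢y ∘ x∈⁅y⁆⇒x≡y y ] (x∈p∪q⁻ ⁅ x ⁆ ⁅ y ⁆ z∈)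

∉allBut : ∀ {n} {x y z : Fin n} → z ∉ allBut x y → z ≡ x ⊎ z ≡ y
∉allBut {x = x} {y} z∉ = Sum.map (x∈⁅y⁆⇒x≡y x) (x∈⁅y⁆⇒x≡y y) (x∈p∪q⁻ ⁅ x ⁆ ⁅ y ⁆ (x∉∁p⇒x∈p z∉))

∣⁅x⁆∪⁅y⁆∣≡2 : ∀ {n} {x y : Fin n} → x ≢ y → ∣ ⁅ x ⁆ ∪ ⁅ y ⁆ ∣ ≡ 2
∣⁅x⁆∪⁅y⁆∣≡2 {x = zero} {zero} x≢y = ⊥-elim (x≢y refl)
∣⁅x⁆∪⁅y⁆∣≡2 {x = zero} {suc y} _ = cong suc (trans (cong ∣_∣ (∪-identityˡ ⁅ y ⁆)) (∣⁅x⁆∣≡1 y))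
∣⁅x⁆∪⁅y⁆∣≡2 {x = suc x} {zero} _ = cong suc (trans (cong ∣_∣ (∪-identityʳ ⁅ x ⁆)) (∣⁅x⁆∣≡1 x))
∣⁅x⁆∪⁅y⁆∣≡2 {x = suc x} {suc y} x≢y = ∣⁅x⁆∪⁅y⁆∣≡2 (x≢y ∘ cong suc)

∣allBut∣≡n∸2 : ∀ {n} {x y : Fin n} → x ≢ y → ∣ allBut x y ∣ ≡ n ∸ 2
∣allBut∣≡n∸2 {n} {x} {y} x≢y = trans (∣∁p∣≡n∸∣p∣ (⁅ x ⁆ ∪ ⁅ y ⁆)) (cong (n ∸_) (∣⁅x⁆∪⁅y⁆∣≡2 x≢y))

nonempty : ∀ {n} {p : Subset n} → 1 ≤ ∣ p ∣ → Nonempty p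
nonempty {p = inside ∷ _} _ = zero , here
nonempty {p = outside ∷ _} 1≤∣p∣ = Product.map suc there (nonempty 1≤∣p∣)

two-distinct : ∀ {n} {p : Subset n} → 2 ≤ ∣ p ∣ → ∃₂ λ x y → x ≢ y × x ∈ p × y ∈ p
two-distinct {p = inside ∷ _} (s≤s 1≤∣p∣) with nonempty 1≤∣p∣
... | x , x∈p = zero , suc x , (λ ()) , here , there x∈p
two-distinct {p = outside ∷ _} 2≤∣p∣ with two-distinct 2≤∣p∣
... | x , y , x≢y , x∈p , y∈p = suc x , suc y , x≢y ∘ suc-injective , there x∈p , there y∈p

three-distinct : ∀ {n} {p : Subset n} → 3 ≤ ∣ p ∣ →
  Σ (Fin n) λ x → Σ (Fin n) λ y → Σ (Fin n) λ z → x ≢ y × x ≢ z × y ≢ z × x ∈ p × y ∈ p × z ∈ p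
three-distinct {p = inside ∷ _} (s≤s 2≤∣p∣) with two-distinct 2≤∣p∣
... | y , z , y≢z , y∈p , z∈p = zero , suc y , suc z , (λ ()) , (λ ()) , y≢z ∘ suc-injective , here , there y∈p , there z∈p
three-distinct {p = outside ∷ _} 3≤∣p∣ with three-distinct 3≤∣p∣
... | x , y , z , x≢y , x≢z , y≢z , x∈p , y∈p , z∈p =
  suc x , suc y , suc z , x≢y ∘ suc-injective , x≢z ∘ suc-injective , y≢z ∘ suc-injective ,
  there x∈p , there y∈p , there z∈p

n∸2≤∣p∣ : ∀ {n} (p : Subset n) →
  (∀ {x y z} → x ≢ y → x ≢ z → y ≢ z → x ∈ p ⊎ y ∈ p ⊎ z ∈ p) → n ∸ 2 ≤ ∣ p ∣
n∸2≤∣p∣ {n} p meets with 3 ≤? ∣ ∁ p ∣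
... | yes 3≤∣∁p∣ with three-distinct 3≤∣∁p∣
...   | _ , _ , _ , x≢y , x≢z , y≢z , x∉p , y∉p , z∉p =
        ⊥-elim ([ x∈∁p⇒x∉p x∉p , [ x∈∁p⇒x∉p y∉p , x∈∁p⇒x∉p z∉p ] ] (meets x≢y x≢z y≢z))
n∸2≤∣p∣ {n} p meets | no 3≰∣∁p∣ = m≤n+o⇒m∸n≤o n 2 (begin
  n                    ≤⟨ m≤n+m∸n n ∣ p ∣ ⟩
  ∣ p ∣ + (n ∸ ∣ p ∣)  ≡⟨ cong (∣ p ∣ +_) (sym (∣∁p∣≡n∸∣p∣ p)) ⟩
  ∣ p ∣ + ∣ ∁ p ∣      ≤⟨ +-monoʳ-≤ ∣ p ∣ (≤-pred (≰⇒> 3≰∣∁p∣)) ⟩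
  ∣ p ∣ + 2            ≡⟨ +-comm ∣ p ∣ 2 ⟩
  2 + ∣ p ∣            ∎)
  where open ≤-Reasoning

pairs⇒triples : ∀ {A : Set} {P Q M : A → Set} → (∀ x → P x ⊎ Q x) →
  (∀ {x y} → x ≢ y → P x → P y → M x ⊎ M y) → (∀ {x y} → x ≢ y → Q x → Q y → M x ⊎ M y) →
  ∀ {x y z} → x ≢ y → x ≢ z → y ≢ z → M x ⊎ M y ⊎ M z
pairs⇒triples classify onP onQ {x} {y} {z} x≢y x≢z y≢z with classify x | classify y | classify z
... | inj₁ px | inj₁ py | _      = Sum.map₂ inj₁ (onP x≢y px py)
... | inj₂ qx | inj₂ qy | _      = Sum.map₂ inj₁ (onQ x≢y qx qy)
... | inj₁ px | inj₂ _  | inj₁ pz = Sum.map₂ inj₂ (onP x≢z px pz)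
... | inj₂ qx | inj₁ _  | inj₂ qz = Sum.map₂ inj₂ (onQ x≢z qx qz)
... | inj₁ _  | inj₂ qy | inj₂ qz = inj₂ (onQ y≢z qy qz)
... | inj₂ _  | inj₁ py | inj₁ pz = inj₂ (onP y≢z py pz)

module GraphFacts {n : ℕ} (G : Graph n) where

  Adj-sym : ∀ {x y} → Adj G x y → Adj G y x
  Adj-sym {x} {y} xy = trans (adj-sym G y x) xy

  Adj⇒≢ : ∀ {x y} → Adj G x y → x ≢ y
  Adj⇒≢ {x} x~x refl with trans (sym x~x) (adj-irr G x)
  ... | ()

  adj? : ∀ x y → Dec (Adj G x y)
  adj? x y = adj G x y Bool.≟ true

  snoc : ∀ {x y z k} → Walk G x y k → Adj G y z → Walk G x z (suc k)
  snoc here yz = step yz here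
  snoc (step xw wy) yz = step xw (snoc wy yz)

  reverse : ∀ {x y k} → Walk G x y k → Walk G y x k
  reverse here = here
  reverse (step xw wy) = snoc (reverse wy) (Adj-sym xw)

  infixr 5 _++ʷ_
  _++ʷ_ : ∀ {x y z k m} → Walk G x y k → Walk G y z m → Walk G x z (k + m)
  here ++ʷ yz = yz
  step xw wy ++ʷ yz = step xw (wy ++ʷ yz)

  walk? : ∀ k x y → Dec (Walk G x y k)
  walk? zero x y with x ≟ y
  ... | yes refl = yes here
  ... | no x≢y = no λ { here → x≢y refl }
  walk? (suc k) x y with any? (λ w → adj? x w ×-dec walk? k w y)
  ... | yes (w , xw , wy) = yes (step xw wy)
  ... | no none = no λ { (step xw wy) → none (_ , xw , wy) }

  walk⇒dist : ∀ {x y k} → Walk G x y k → ∃[ d ] IsDist G x y d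
  walk⇒dist {x} {y} xy with least-witness (λ k → walk? k x y) xy
  ... | d , xy-d , least = d , xy-d , λ _ → least

  dist : Connected G → ∀ x y → ∃[ d ] IsDist G x y d
  dist connected x y = walk⇒dist (proj₂ (connected x y))

  dist-refl : ∀ {x} → IsDist G x x 0
  dist-refl = here , λ _ _ → z≤n

  dist-adj : ∀ {x y} → Adj G x y → IsDist G x y 1
  dist-adj xy = step xy here , λ { _ here → ⊥-elim (Adj⇒≢ xy refl) ; _ (step _ _) → s≤s z≤n }

  dist-two : ∀ {x y z} → Adj G x y → Adj G y z → x ≢ z → ¬ Adj G x z → IsDist G x z 2
  dist-two xy yz x≢z ¬xz = step xy (step yz here) , λ
    { _ here → ⊥-elim (x≢z refl)
    ; _ (step xz here) → ⊥-elim (¬xz xz)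
    ; _ (step _ (step _ _)) → s≤s (s≤s z≤n) }

  -- y lies on a shortest x–w walk.  StronglyResolves G w x y unfolds to Between x y w ⊎ Between y x w.
  Between : Fin n → Fin n → Fin n → Set
  Between x y w = Σ ℕ λ a → Σ ℕ λ b → Σ ℕ λ c →
    IsDist G x w a × IsDist G x y b × IsDist G y w c × a ≡ b + c

  resolves-sym : ∀ {w x y} → StronglyResolves G w x y → StronglyResolves G w y x
  resolves-sym (inj₁ between) = inj₂ between
  resolves-sym (inj₂ between) = inj₁ between

  resolves-self : Connected G → ∀ x y → StronglyResolves G x x y
  resolves-self connected x y with dist connected y x
  ... | d , yx = inj₂ (d , d , 0 , yx , yx , dist-refl , sym (+-identityʳ d))

  Pendant : Fin n → Set
  Pendant y = ∀ {p q} → Adj G y p → Adj G y q → p ≡ q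

  -- A walk through a pendant vertex enters and leaves it along its only edge; skipping both shortens it by 2.
  pendant-not-interior : ∀ {x y w b c} → Pendant y → IsDist G x w (b + c) →
                         Walk G y x b → Walk G y w c → y ≡ x ⊎ y ≡ w
  pendant-not-interior _ _ here _ = inj₁ refl
  pendant-not-interior _ _ (step _ _) here = inj₂ refl
  pendant-not-interior {w = w} pendant (_ , shortest) (step {w = p} {k = b} yp px) (step {w = q} {k = c} yq qw) =
    ⊥-elim (<⇒≱ (+-mono-< ≤-refl ≤-refl) (shortest (b + c) (reverse px ++ʷ pw)))
    where
    pw : Walk G p w c
    pw = subst (λ p → Walk G p w c) (sym (pendant yp yq)) qw

  pendant-not-between : ∀ {x y w} → Pendant y → Between x y w → y ≡ x ⊎ y ≡ w
  pendant-not-between pendant (_ , _ , _ , xw , (xy , _) , (yw , _) , refl) =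
    pendant-not-interior pendant xw (reverse xy) yw

  pendant-pair-resolvers : ∀ {w x y} → Pendant x → Pendant y → x ≢ y →
                           StronglyResolves G w x y → w ≡ x ⊎ w ≡ y
  pendant-pair-resolvers _ pendant-y x≢y (inj₁ between) =
    [ ⊥-elim ∘ x≢y ∘ sym , inj₂ ∘ sym ] (pendant-not-between pendant-y between)
  pendant-pair-resolvers pendant-x _ x≢y (inj₂ between) =
    [ ⊥-elim ∘ x≢y , inj₁ ∘ sym ] (pendant-not-between pendant-x between)

  between-farther : ∀ {x y w m} → Between x y w → (∀ k → Walk G x y k → m ≤ k) →
                    ∀ k → Walk G x w k → m ≤ k
  between-farther (_ , b , c , (_ , xw-min) , (xy , _) , _ , refl) far k xw =
    ≤-trans (far b xy) (≤-trans (m≤m+n b c) (xw-min k xw))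

  far-pair-resolvers : ∀ {w x y m} → (∀ k → Walk G x y k → m ≤ k) →
    (∀ z → z ≢ x → z ≢ y → (∃[ k ] k < m × Walk G x z k) × (∃[ k ] k < m × Walk G y z k)) →
    StronglyResolves G w x y → w ≡ x ⊎ w ≡ y
  far-pair-resolvers {w} {x} {y} far near r with w ≟ x | w ≟ y
  ... | yes w≡x | _ = inj₁ w≡x
  ... | no _ | yes w≡y = inj₂ w≡y
  ... | no w≢x | no w≢y with near w w≢x w≢y | r
  ...   | (k , k<m , xw) , _ | inj₁ between = ⊥-elim (<⇒≱ k<m (between-farther between far k xw))
  ...   | _ , (k , k<m , yw) | inj₂ between =
          ⊥-elim (<⇒≱ k<m (between-farther between (λ k → far k ∘ reverse) k yw))

  generator-meets-pair : ∀ {S x y} → IsStrongMetricGenerator G S → x ≢ y →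
                         (∀ {w} → StronglyResolves G w x y → w ≡ x ⊎ w ≡ y) → x ∈ S ⊎ y ∈ S
  generator-meets-pair generator x≢y only-ends with generator _ _ x≢y
  ... | w , w∈S , r with only-ends r
  ...   | inj₁ refl = inj₁ w∈S
  ...   | inj₂ refl = inj₂ w∈S

  all-but-pair-generator : ∀ {w x y} → Connected G → w ≢ x → w ≢ y → StronglyResolves G w x y →
                           IsStrongMetricGenerator G (allBut x y)
  all-but-pair-generator {w} {x} {y} connected w≢x w≢y r p q p≢q with p ∈? allBut x y | q ∈? allBut x y
  ... | yes p∈S | _ = p , p∈S , resolves-self connected p q
  ... | no _ | yes q∈S = q , q∈S , resolves-sym (resolves-self connected q p)
  ... | no p∉S | no q∉S with ∉allBut p∉S | ∉allBut q∉S
  ...   | inj₁ refl | inj₁ refl = ⊥-elim (p≢q refl)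
  ...   | inj₁ refl | inj₂ refl = w , ∈allBut w≢x w≢y , r
  ...   | inj₂ refl | inj₁ refl = w , ∈allBut w≢x w≢y , resolves-sym r
  ...   | inj₂ refl | inj₂ refl = ⊥-elim (p≢q refl)

  data Route : Fin n → Fin n → List (Fin n) → Set where
    []  : ∀ {s} → Route s s []
    _∷_ : ∀ {s w t xs} → Adj G s w → Route w t xs → Route s t (w ∷ xs)

  route-end∈ : ∀ {s t x xs} → Route s t (x ∷ xs) → t ∈ˡ x ∷ xs
  route-end∈ (_ ∷ []) = here refl
  route-end∈ (_ ∷ route@(_ ∷ _)) = there (route-end∈ route)

  route⇒chain : ∀ {s t xs} → Route s t xs → Chain G s xs
  route⇒chain [] = end
  route⇒chain (sw ∷ route) = link sw (route⇒chain route)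

  Chain-++⁻ˡ : ∀ {s} (ys : List (Fin n)) {zs} → Chain G s (ys ++ zs) → Chain G s ys
  Chain-++⁻ˡ [] _ = end
  Chain-++⁻ˡ (_ ∷ ys) (link sy chain) = link sy (Chain-++⁻ˡ ys chain)

  Unique-++⁻ˡ : ∀ (ys : List (Fin n)) {zs} → Unique (ys ++ zs) → Unique ys
  Unique-++⁻ˡ [] _ = []
  Unique-++⁻ˡ (_ ∷ ys) (y∉ ∷ unique) = ++⁻ˡ ys y∉ ∷ Unique-++⁻ˡ ys unique

  Adjᶜ⁺ : ∀ {x y} → ¬ Adj G x y → x ≢ y → Adj (complement G) x y
  Adjᶜ⁺ {x} {y} ¬xy x≢y with adj G x y | x ≟ y
  ... | false | no _ = refl
  ... | true | _ = ⊥-elim (¬xy refl)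
  ... | false | yes x≡y = ⊥-elim (x≢y x≡y)

  Adjᶜ⇒¬Adj : ∀ {x y} → Adj (complement G) x y → ¬ Adj G x y
  Adjᶜ⇒¬Adj {x} {y} xyᶜ xy with adj G x y
  Adjᶜ⇒¬Adj () refl | true

module AcyclicFacts {n : ℕ} {G : Graph n} (acyclic : Acyclic G) where

  open GraphFacts G
  open import Data.List.Membership.DecPropositional (_≟_ {n = n}) using () renaming (_∈?_ to _∈ˡ?_)

  no-triangle : ∀ {x y z} → Adj G x y → Adj G y z → Adj G z x → ⊥
  no-triangle xy yz zx = acyclic (cycle _ (_ ∷ []) _ (s≤s (s≤s z≤n))
    ((Adj⇒≢ xy ∷ ≢-sym (Adj⇒≢ zx) ∷ []) ∷ (Adj⇒≢ yz ∷ []) ∷ [] ∷ [])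
    (link xy (link yz end)) zx)

  no-square : ∀ {x y z w} → Adj G x y → Adj G y z → Adj G z w → Adj G w x → x ≢ z → y ≢ w → ⊥
  no-square xy yz zw wx x≢z y≢w = acyclic (cycle _ (_ ∷ _ ∷ []) _ (s≤s (s≤s z≤n))
    ((Adj⇒≢ xy ∷ x≢z ∷ ≢-sym (Adj⇒≢ wx) ∷ []) ∷ (Adj⇒≢ yz ∷ y≢w ∷ []) ∷ (Adj⇒≢ zw ∷ []) ∷ [] ∷ [])
    (link xy (link yz (link zw end))) wx)

  -- Induction on the walk: its first step either extends the path backwards or, if it lands on
  -- the path, shortcuts it (landing beyond the second vertex would close a cycle).
  path-length≤walk : ∀ {s t xs k} → Route s t xs → Unique (s ∷ xs) → Walk G s t k → length xs ≤ k
  path-length≤walk [] _ _ = z≤n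
  path-length≤walk route@(_ ∷ _) (s∉ ∷ _) here = ⊥-elim (lookup s∉ (route-end∈ route) refl)
  path-length≤walk {s} {xs = xs} route unique (step {w = q} sq qt) with q ∈ˡ? xs
  ... | no q∉xs =
    ≤-trans (n≤1+n _) (m≤n⇒m≤1+n (path-length≤walk (Adj-sym sq ∷ route)
      ((≢-sym (Adj⇒≢ sq) ∷ ¬Any⇒All¬ xs q∉xs) ∷ unique) qt))
  ... | yes q∈xs with ∈-∃++ q∈xs
  ...   | [] , zs , refl with route | unique
  ...     | _ ∷ route′ | _ ∷ unique′ = s≤s (path-length≤walk route′ unique′ qt)
  path-length≤walk {s} route unique (step {w = q} sq qt) | yes _ | y ∷ ys , zs , refl =
    ⊥-elim (acyclic (cycle s (y ∷ ys) q (s≤s (s≤s z≤n)) cycle-unique cycle-chain (Adj-sym sq)))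
    where
    reassoc : ys ++ q ∷ zs ≡ (ys ++ q ∷ []) ++ zs
    reassoc = sym (++-assoc ys (q ∷ []) zs)
    cycle-unique : Unique (s ∷ y ∷ ys ++ q ∷ [])
    cycle-unique = Unique-++⁻ˡ (s ∷ y ∷ ys ++ q ∷ []) (subst (λ l → Unique (s ∷ y ∷ l)) reassoc unique)
    cycle-chain : Chain G s (y ∷ ys ++ q ∷ [])
    cycle-chain = Chain-++⁻ˡ (y ∷ ys ++ q ∷ []) (subst (λ l → Chain G s (y ∷ l)) reassoc (route⇒chain route))

  nonbacktracking-walk₄-unique : ∀ {v₀ v₁ v₂ v₃ v₄} →
    Adj G v₀ v₁ → Adj G v₁ v₂ → Adj G v₂ v₃ → Adj G v₃ v₄ → v₀ ≢ v₂ → v₁ ≢ v₃ → v₂ ≢ v₄ →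
    Unique (v₀ ∷ v₁ ∷ v₂ ∷ v₃ ∷ v₄ ∷ [])
  nonbacktracking-walk₄-unique {v₀} {v₁} {v₂} {v₃} {v₄} e₀₁ e₁₂ e₂₃ e₃₄ v₀≢v₂ v₁≢v₃ v₂≢v₄ =
    (Adj⇒≢ e₀₁ ∷ v₀≢v₂ ∷ v₀≢v₃ ∷ v₀≢v₄ ∷ []) ∷ (Adj⇒≢ e₁₂ ∷ v₁≢v₃ ∷ v₁≢v₄ ∷ []) ∷
    (Adj⇒≢ e₂₃ ∷ v₂≢v₄ ∷ []) ∷ (Adj⇒≢ e₃₄ ∷ []) ∷ [] ∷ []
    where
    v₀≢v₃ : v₀ ≢ v₃
    v₀≢v₃ refl = no-triangle e₀₁ e₁₂ e₂₃
    v₁≢v₄ : v₁ ≢ v₄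
    v₁≢v₄ refl = no-triangle e₁₂ e₂₃ e₃₄
    v₀≢v₄ : v₀ ≢ v₄
    v₀≢v₄ refl = no-square e₀₁ e₁₂ e₂₃ e₃₄ v₀≢v₂ v₁≢v₃

module DiameterThreeTree {n : ℕ} (T : Graph n) (acyclic : Acyclic T) (connected : Connected T)
                         (diam≤3 : ∀ x y e → IsDist T x y e → e ≤ 3) where

  open GraphFacts T
  open AcyclicFacts acyclic

  Tc : Graph n
  Tc = complement T

  module ᶜ = GraphFacts Tc

  walk-within-3 : ∀ x y → ∃[ k ] k ≤ 3 × Walk T x y k
  walk-within-3 x y with dist connected x y
  ... | d , xy@(walk , _) = d , diam≤3 x y d xy , walk

  no-nonbacktracking-walk₄ : ∀ {v₀ v₁ v₂ v₃ v₄} →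
    Adj T v₀ v₁ → Adj T v₁ v₂ → Adj T v₂ v₃ → Adj T v₃ v₄ → v₀ ≢ v₂ → v₁ ≢ v₃ → v₂ ≢ v₄ → ⊥
  no-nonbacktracking-walk₄ {v₀} {v₄ = v₄} e₀₁ e₁₂ e₂₃ e₃₄ v₀≢v₂ v₁≢v₃ v₂≢v₄ with walk-within-3 v₀ v₄
  ... | _ , k≤3 , walk = <⇒≱ (s≤s k≤3) (path-length≤walk (e₀₁ ∷ e₁₂ ∷ e₂₃ ∷ e₃₄ ∷ [])
          (nonbacktracking-walk₄-unique e₀₁ e₁₂ e₂₃ e₃₄ v₀≢v₂ v₁≢v₃ v₂≢v₄) walk)

  module DiametralPath {u a b v : Fin n} (ua : Adj T u a) (ab : Adj T a b) (bv : Adj T b v)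
                       (far : ∀ k → Walk T u v k → 3 ≤ k) where

    too-short : ∀ {k} → Walk T u v k → k < 3 → ⊥
    too-short uv k<3 = <⇒≱ k<3 (far _ uv)

    u≢a : u ≢ a
    u≢a = Adj⇒≢ ua

    a≢b : a ≢ b
    a≢b = Adj⇒≢ ab

    b≢v : b ≢ v
    b≢v = Adj⇒≢ bv

    u≢b : u ≢ b
    u≢b refl = too-short (step bv here) (s≤s (s≤s z≤n))

    a≢v : a ≢ v
    a≢v refl = too-short (step ua here) (s≤s (s≤s z≤n))

    u≢v : u ≢ v
    u≢v refl = too-short here (s≤s z≤n)

    ¬u~b : ¬ Adj T u b
    ¬u~b ub = too-short (step ub (step bv here)) ≤-refl

    ¬a~v : ¬ Adj T a v
    ¬a~v av = too-short (step ua (step av here)) ≤-refl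

    ¬u~v : ¬ Adj T u v
    ¬u~v uv = too-short (step uv here) (s≤s (s≤s z≤n))

    NonCentral : Fin n → Set
    NonCentral x = x ≢ a × x ≢ b

    -- Otherwise a walk of length ≤ 3 from w to a contains, or extends along the path to,
    -- a non-backtracking walk of length 4.
    adjacent-to-centre : ∀ {w} → NonCentral w → Adj T w a ⊎ Adj T w b
    adjacent-to-centre {w} (w≢a , w≢b) with adj? w a | adj? w b
    ... | yes wa | _ = inj₁ wa
    ... | no _ | yes wb = inj₂ wb
    ... | no ¬wa | no ¬wb with walk-within-3 w a
    ...   | _ , k≤3 , walk = ⊥-elim (absurd walk k≤3)
      where
      absurd : ∀ {k} → Walk T w a k → k ≤ 3 → ⊥
      absurd here _ = w≢a refl
      absurd (step wa here) _ = ¬wa wa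
      absurd (step wp (step pa here)) _ = no-nonbacktracking-walk₄ wp pa ab bv w≢a (λ { refl → ¬wb wp }) a≢v
      absurd (step {w = p} wp (step {w = q} pq (step qa here))) _ with q ≟ b
      ... | yes refl = no-nonbacktracking-walk₄ wp pq (Adj-sym ab) (Adj-sym ua) w≢b (λ { refl → ¬wa wp }) (≢-sym u≢b)
      ... | no q≢b = no-nonbacktracking-walk₄ pq qa ab bv (λ { refl → ¬wa wp }) q≢b a≢v
      absurd (step _ (step _ (step _ (step _ _)))) (s≤s (s≤s (s≤s ())))

    no-common-neighbour : ∀ {w} → Adj T w a → Adj T w b → ⊥
    no-common-neighbour wa wb = no-triangle wa ab (Adj-sym wb)

    noncentral-nonadjacent : ∀ {x y} → NonCentral x → NonCentral y → ¬ Adj T x y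
    noncentral-nonadjacent nx@(x≢a , x≢b) ny@(y≢a , y≢b) xy with adjacent-to-centre nx | adjacent-to-centre ny
    ... | inj₁ xa | inj₁ ya = no-triangle xa (Adj-sym ya) (Adj-sym xy)
    ... | inj₁ xa | inj₂ yb = no-square xa ab (Adj-sym yb) (Adj-sym xy) x≢b (≢-sym y≢a)
    ... | inj₂ xb | inj₁ ya = no-square xb (Adj-sym ab) (Adj-sym ya) (Adj-sym xy) x≢a (≢-sym y≢b)
    ... | inj₂ xb | inj₂ yb = no-triangle xb (Adj-sym yb) (Adj-sym xy)

    noncentral-neighbour : ∀ {y p} → NonCentral y → Adj T y p → p ≡ a ⊎ p ≡ b
    noncentral-neighbour {p = p} ny yp with p ≟ a | p ≟ b
    ... | yes p≡a | _ = inj₁ p≡a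
    ... | no _ | yes p≡b = inj₂ p≡b
    ... | no p≢a | no p≢b = ⊥-elim (noncentral-nonadjacent ny (p≢a , p≢b) yp)

    noncentral-pendant : ∀ {y} → NonCentral y → Pendant y
    noncentral-pendant ny yp yq with noncentral-neighbour ny yp | noncentral-neighbour ny yq
    ... | inj₁ refl | inj₁ refl = refl
    ... | inj₂ refl | inj₂ refl = refl
    ... | inj₁ refl | inj₂ refl = ⊥-elim (no-common-neighbour yp yq)
    ... | inj₂ refl | inj₁ refl = ⊥-elim (no-common-neighbour yq yp)

    centres-far : ∀ k → Walk Tc a b k → 3 ≤ k
    centres-far _ here = ⊥-elim (a≢b refl)
    centres-far _ (step abᶜ here) = ⊥-elim (Adjᶜ⇒¬Adj abᶜ ab)
    centres-far _ (step apᶜ (step pbᶜ here)) with adjacent-to-centre (≢-sym (ᶜ.Adj⇒≢ apᶜ) , ᶜ.Adj⇒≢ pbᶜ)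
    ... | inj₁ pa = ⊥-elim (Adjᶜ⇒¬Adj apᶜ (Adj-sym pa))
    ... | inj₂ pb = ⊥-elim (Adjᶜ⇒¬Adj pbᶜ pb)
    centres-far _ (step _ (step _ (step _ _))) = s≤s (s≤s (s≤s z≤n))

    near-a : ∀ {w} → w ≢ a → w ≢ b → ∃[ k ] k < 3 × Walk Tc a w k
    near-a {w} w≢a w≢b with adjacent-to-centre (w≢a , w≢b)
    ... | inj₁ wa = 2 , ≤-refl , step (Adjᶜ⁺ ¬a~v a≢v) (step (Adjᶜ⁺ ¬v~w v≢w) here)
      where
      v≢w : v ≢ w
      v≢w refl = ¬a~v (Adj-sym wa)
      ¬v~w : ¬ Adj T v w
      ¬v~w = noncentral-nonadjacent (≢-sym a≢v , ≢-sym b≢v) (w≢a , w≢b)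
    ... | inj₂ wb = 1 , s≤s (s≤s z≤n) , step (Adjᶜ⁺ (λ aw → no-common-neighbour (Adj-sym aw) wb) (≢-sym w≢a)) here

  module Dimension {u a b v : Fin n} (ua : Adj T u a) (ab : Adj T a b) (bv : Adj T b v)
                   (far : ∀ k → Walk T u v k → 3 ≤ k) where

    open DiametralPath ua ab bv far
    module Mirror = DiametralPath (Adj-sym bv) (Adj-sym ab) (Adj-sym ua) (λ k → far k ∘ reverse)

    a~ᶜv : Adj Tc a v
    a~ᶜv = Adjᶜ⁺ ¬a~v a≢v

    v~ᶜu : Adj Tc v u
    v~ᶜu = Adjᶜ⁺ (¬u~v ∘ Adj-sym) (≢-sym u≢v)

    u~ᶜb : Adj Tc u b
    u~ᶜb = Adjᶜ⁺ ¬u~b u≢b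

    centres-walk : Walk Tc a b 3
    centres-walk = step a~ᶜv (step v~ᶜu (step u~ᶜb here))

    from-a : ∀ w → ∃[ k ] Walk Tc a w k
    from-a w with w ≟ a | w ≟ b
    ... | yes refl | _ = 0 , here
    ... | no _ | yes refl = 3 , centres-walk
    ... | no w≢a | no w≢b = Product.map₂ proj₂ (near-a w≢a w≢b)

    complement-connected : Connected Tc
    complement-connected x y with from-a x | from-a y
    ... | k , ax | m , ay = k + m , ᶜ.reverse ax ᶜ.++ʷ ay

    centre-resolvers : ∀ {w} → StronglyResolves Tc w a b → w ≡ a ⊎ w ≡ b
    centre-resolvers = ᶜ.far-pair-resolvers centres-far
      (λ w w≢a w≢b → near-a w≢a w≢b , Mirror.near-a w≢b w≢a)

    b-resolves-u-a-in-T : StronglyResolves T b u a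
    b-resolves-u-a-in-T = inj₁ (2 , 1 , 1 , dist-two ua ab u≢b ¬u~b , dist-adj ua , dist-adj ab , refl)

    b-resolves-u-a-in-Tc : StronglyResolves Tc b u a
    b-resolves-u-a-in-Tc = inj₂ (3 , 2 , 1 , (centres-walk , centres-far) ,
      ᶜ.dist-two a~ᶜv v~ᶜu (≢-sym u≢a) (λ auᶜ → Adjᶜ⇒¬Adj auᶜ (Adj-sym ua)) , ᶜ.dist-adj u~ᶜb , refl)

    all-but-u-a-generator : IsSimStrongMetricGenerator T Tc (allBut u a)
    all-but-u-a-generator =
      all-but-pair-generator connected (≢-sym u≢b) (≢-sym a≢b) b-resolves-u-a-in-T ,
      ᶜ.all-but-pair-generator complement-connected (≢-sym u≢b) (≢-sym a≢b) b-resolves-u-a-in-Tc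

    classify : ∀ x → NonCentral x ⊎ (x ≡ a ⊎ x ≡ b)
    classify x with x ≟ a | x ≟ b
    ... | yes x≡a | _ = inj₂ (inj₁ x≡a)
    ... | no _ | yes x≡b = inj₂ (inj₂ x≡b)
    ... | no x≢a | no x≢b = inj₁ (x≢a , x≢b)

    generator-lower-bound : ∀ S → IsSimStrongMetricGenerator T Tc S → n ∸ 2 ≤ ∣ S ∣
    generator-lower-bound S (generator , generatorᶜ) = n∸2≤∣p∣ S (pairs⇒triples classify noncentral-pair central-pair)
      where
      noncentral-pair : ∀ {x y} → x ≢ y → NonCentral x → NonCentral y → x ∈ S ⊎ y ∈ S
      noncentral-pair x≢y nx ny = generator-meets-pair generator x≢y
        (pendant-pair-resolvers (noncentral-pendant nx) (noncentral-pendant ny) x≢y)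
      centres-meet : a ∈ S ⊎ b ∈ S
      centres-meet = ᶜ.generator-meets-pair generatorᶜ a≢b centre-resolvers
      central-pair : ∀ {x y} → x ≢ y → x ≡ a ⊎ x ≡ b → y ≡ a ⊎ y ≡ b → x ∈ S ⊎ y ∈ S
      central-pair x≢y (inj₁ refl) (inj₁ refl) = ⊥-elim (x≢y refl)
      central-pair _ (inj₁ refl) (inj₂ refl) = centres-meet
      central-pair _ (inj₂ refl) (inj₁ refl) = Sum.swap centres-meet
      central-pair x≢y (inj₂ refl) (inj₂ refl) = ⊥-elim (x≢y refl)

    metric-dimension : SimStrongMetricDim≡ T Tc (n ∸ 2)
    metric-dimension = (allBut u a , all-but-u-a-generator , ∣allBut∣≡n∸2 u≢a) , generator-lower-bound

mainTheorem10 : (n : ℕ) (T : Graph n) → IsTree T → HasDiameter T 3 →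
    Connected (complement T) × SimStrongMetricDim≡ T (complement T) (n ∸ 2)
mainTheorem10 n T (connected , acyclic) (diam≤3 , _ , _ , step ua (step ab (step bv here)) , far) =
  complement-connected , metric-dimension
  where
  open DiameterThreeTree T acyclic connected diam≤3
  open Dimension ua ab bv far
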